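{- Let $b$ be a positive integer, let $S_{1,b}$ be the double star and let $m=b+2$ be its number of edges. If $S_{1,b}+cP_3$ is antimagic for a nonnegative integer $c$, then $c\le 2m+1$.
   Context: All graphs are simple. For a graph $G$ with $m$ edges, an antimagic labeling is a bijection $f:E(G)\to\{1,\dots,m\}$ such that the vertex sums $\phi(v)=\sum_{e\ni v} f(e)$ are pairwise distinct; $G$ is antimagic if it has such a labeling. $G+cP_3$ denotes the disjoint union of $G$ with $c$ copies of the path $P_3$ on 3 vertices. The double star $S_{a,b}$ is the tree consisting of an edge $xy$ together with $a$ pendant edges attached at $x$ and $b$ pendant edges attached at $y$; it has $a+b+1$ edges. -}

module Defs where

open import Data.Nat using (ℕ; zero; suc; _+_; _*_; _<_)
open import Data.Nat.Properties using (_≟_)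
open import Data.Fin using (Fin; toℕ)
open import Data.Product using (_×_; _,_; Σ; ∃)
open import Data.List using (List; []; _∷_; _++_; length; map; lookup)
open import Data.Vec.Functional using (Vector)
open import Data.Bool using (Bool; true; false; _∨_; if_then_else_)
open import Relation.Nullary.Decidable using (⌊_⌋)
open import Relation.Binary.PropositionalEquality using (_≡_)
open import Function.Bundles using (_⤖_; Bijection)
open import Function.Definitions using (Injective)

-- A (finite, simple) graph given by its number of vertices n (vertices are
-- 0,…,n-1) and the list of its edges as pairs of endpoints.
record Graph : Set where
  field
    nV    : ℕ
    edges : List (ℕ × ℕ)

open Graph public

nE : Graph → ℕ
nE G = length (edges G)

edge : (G : Graph) → Fin (nE G) → ℕ × ℕ
edge G i = lookup (edges G) i

incident : ℕ → ℕ × ℕ → Bool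
incident v (a , b) = ⌊ v ≟ a ⌋ ∨ ⌊ v ≟ b ⌋

sumFin : (m : ℕ) → (Fin m → ℕ) → ℕ
sumFin zero    g = 0
sumFin (suc m) g = g Fin.zero + sumFin m (λ i → g (Fin.suc i))


-- A labeling: a bijection from the edge indices to Fin m; edge i gets label
-- 1 + toℕ (f i), so labels range over {1,…,m}.
Labeling : Graph → Set
Labeling G = Fin (nE G) ⤖ Fin (nE G)

vertexSum : (G : Graph) → Labeling G → ℕ → ℕ
vertexSum G f v =
  sumFin (nE G) (λ i → if incident v (edge G i)
                         then suc (toℕ (Bijection.to f i)) else 0)

IsAntimagicLabeling : (G : Graph) → Labeling G → Set
IsAntimagicLabeling G f =
  Injective _≡_ _≡_ (λ (v : Fin (nV G)) → vertexSum G f (toℕ v))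

Antimagic : Graph → Set
Antimagic G = Σ (Labeling G) (IsAntimagicLabeling G)

shift : ℕ → ℕ × ℕ → ℕ × ℕ
shift k (a , b) = (k + a , k + b)

_⊕_ : Graph → Graph → Graph
G ⊕ H = record { nV = nV G + nV H
               ; edges = edges G ++ map (shift (nV G)) (edges H) }

P3 : Graph
P3 = record { nV = 3 ; edges = (0 , 1) ∷ (1 , 2) ∷ [] }

emptyGraph : Graph
emptyGraph = record { nV = 0 ; edges = [] }

copiesP3 : ℕ → Graph
copiesP3 zero    = emptyGraph
copiesP3 (suc c) = P3 ⊕ copiesP3 c


-- Double star S_{a,b}; here a = 1 only is needed, but we define the general
-- one: x = 0, y = 1, the a leaves of x are 2,…,a+1, the b leaves of y are
-- a+2,…,a+b+1.
leavesAt : ℕ → ℕ → ℕ → List (ℕ × ℕ)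
leavesAt centre start zero    = []
leavesAt centre start (suc k) = (centre , start + k) ∷ leavesAt centre start k

doubleStar : ℕ → ℕ → Graph
doubleStar a b = record
  { nV = a + b + 2
  ; edges = (0 , 1) ∷ leavesAt 0 2 a ++ leavesAt 1 (2 + a) b }

-- Let f be antimagic on S_{1,b} + cP₃, with M = m + 2c edges. Every edge other than xy has an
-- endpoint of degree 1, whose vertex sum is the label of that edge, so vertex sums of leaves
-- realise every label except f(xy). The c + 1 vertices x and the centres of the paths have
-- degree 2 and are pairwise non-adjacent, so their vertex sums are sums of disjoint pairs of
-- labels; these sums are distinct and, being no leaf sum, at most one of them is ≤ M. Dropping
-- that one, c distinct integers > M add up to at least c(M + 1) + (c choose 2), while as a sum
-- of 2c distinct labels ≤ M the same total is at most 2cM − (2c choose 2).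
module Submission where

open import Defs
open import Data.Bool using (Bool; true; false; if_then_else_; _∨_)
open import Data.Bool.Properties using (T-∨; T-≡; ¬-not)
open import Data.Empty using (⊥-elim)
open import Data.Fin as Fin using (Fin; toℕ; fromℕ<; punchIn; punchOut; splitAt)
open import Data.Fin.Properties as Fin
  using (any?; pigeonhole; fromℕ<-injective; punchIn-injective; punchInᵢ≢i; punchIn-punchOut)
open import Data.List using (List; []; _∷_; _++_; map; length; lookup)
open import Data.List.Membership.Propositional.Properties using (∈-lookup)
open import Data.List.Properties using (length-++; length-map)
open import Data.List.Relation.Unary.All as All using (All; []; _∷_)
open import Data.List.Relation.Unary.All.Properties using (++⁺; map⁺)
open import Data.Nat using (ℕ; zero; suc; _+_; _*_; _∸_; _≤_; _<_; z≤n; s≤s; z<s; s<s; _≤?_)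
open import Data.Nat.Combinatorics using (_C_; nC1≡n; nCk+nC[k+1]≡[n+1]C[k+1])
open import Data.Nat.Properties
open import Algebra.Properties.CommutativeMonoid.Sum +-0-commutativeMonoid
  using (sum; sum-remove; sum-cong-≗; ∑-distrib-+)
open import Data.Nat.Tactic.RingSolver using (solve-∀)
open import Data.Product as Product using (∃; _×_; _,_)
open import Data.Sum as Sum using (_⊎_; inj₁; inj₂)
open import Data.Sum.Properties using (inj₁-injective; inj₂-injective)
open import Data.Vec.Functional using (removeAt)
open import Function using (_∘_; const)
open import Function.Bundles using (Equivalence; mk⇔; Bijection)
open import Function.Definitions using (Injective)
open import Relation.Binary.PropositionalEquality
open import Relation.Nullary using (¬_; yes; no)
open import Relation.Nullary.Decidable using (⌊_⌋; toWitness; fromWitness; isYes≗does; does-⇔)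

-- Sums of distinct natural numbers

sumFin≡sum : ∀ n (g : Fin n → ℕ) → sumFin n g ≡ sum g
sumFin≡sum zero    g = refl
sumFin≡sum (suc n) g = cong (g Fin.zero +_) (sumFin≡sum n (g ∘ Fin.suc))

sum-const : ∀ n a → sum {n} (const a) ≡ n * a
sum-const zero    a = refl
sum-const (suc n) a = cong (a +_) (sum-const n a)

sum-splitAt : ∀ m {n} (g : Fin m ⊎ Fin n → ℕ) →
              sum (g ∘ splitAt m) ≡ sum (g ∘ inj₁) + sum (g ∘ inj₂)
sum-splitAt zero    g = refl
sum-splitAt (suc m) g =
  trans (cong (g (inj₁ Fin.zero) +_) (sum-splitAt m (g ∘ Sum.map₁ Fin.suc)))
        (sym (+-assoc (g (inj₁ Fin.zero)) (sum (g ∘ inj₁ ∘ Fin.suc)) (sum (g ∘ inj₂))))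

[1+n]C2≡n+nC2 : ∀ n → suc n C 2 ≡ n + n C 2
[1+n]C2≡n+nC2 n = trans (sym (nCk+nC[k+1]≡[n+1]C[k+1] n 1)) (cong (_+ n C 2) (nC1≡n n))

2*nC2+n≡n*n : ∀ n → 2 * (n C 2) + n ≡ n * n
2*nC2+n≡n*n zero    = refl
2*nC2+n≡n*n (suc n) = begin
  2 * (suc n C 2) + suc n       ≡⟨ cong (λ x → 2 * x + suc n) ([1+n]C2≡n+nC2 n) ⟩
  2 * (n + n C 2) + suc n       ≡⟨ regroup n (n C 2) ⟩
  suc (2 * (n C 2) + n) + 2 * n ≡⟨ cong (λ x → suc x + 2 * n) (2*nC2+n≡n*n n) ⟩
  suc (n * n) + 2 * n           ≡⟨ square n ⟩
  suc n * suc n                 ∎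
  where
  open ≡-Reasoning
  regroup : ∀ n x → 2 * (n + x) + suc n ≡ suc (2 * x + n) + 2 * n
  regroup = solve-∀
  square : ∀ n → suc (n * n) + 2 * n ≡ suc n * suc n
  square = solve-∀

bounded⇒¬injective : ∀ {n} (g : Fin (suc n) → ℕ) → (∀ i → g i < n) → ¬ Injective _≡_ _≡_ g
bounded⇒¬injective {n} g g<n g-inj =
  let (i , j , i<j , eq) = pigeonhole (n<1+n n) (λ i → fromℕ< (g<n i))
  in Fin.<⇒≢ i<j (g-inj (fromℕ<-injective _ _ (g<n i) (g<n j) eq))

injective⇒∃≥n : ∀ {n} (g : Fin (suc n) → ℕ) → Injective _≡_ _≡_ g → ∃ λ i → n ≤ g i
injective⇒∃≥n {n} g g-inj with any? (λ i → n ≤? g i)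
... | yes large = large
... | no ¬large = ⊥-elim (bounded⇒¬injective g (λ i → ≰⇒> (¬large ∘ (i ,_))) g-inj)

injective⇒nC2≤sum : ∀ {n} (g : Fin n → ℕ) → Injective _≡_ _≡_ g → n C 2 ≤ sum g
injective⇒nC2≤sum {zero}  g _     = z≤n
injective⇒nC2≤sum {suc n} g g-inj with injective⇒∃≥n g g-inj
... | i , n≤gᵢ = begin
  suc n C 2                ≡⟨ [1+n]C2≡n+nC2 n ⟩
  n + n C 2                ≤⟨ +-mono-≤ n≤gᵢ (injective⇒nC2≤sum (removeAt g i) removeAt-inj) ⟩
  g i + sum (removeAt g i) ≡⟨ sum-remove g ⟨
  sum g                    ∎
  where
  open ≤-Reasoning
  removeAt-inj : Injective _≡_ _≡_ (removeAt g i)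
  removeAt-inj = punchIn-injective i _ _ ∘ g-inj

injective⇒n*a+nC2≤sum : ∀ {n} a (g : Fin n → ℕ) → Injective _≡_ _≡_ g → (∀ i → a ≤ g i) →
                        n * a + n C 2 ≤ sum g
injective⇒n*a+nC2≤sum {n} a g g-inj a≤g = begin
  n * a + n C 2               ≤⟨ +-monoʳ-≤ (n * a) (injective⇒nC2≤sum g∸a g∸a-inj) ⟩
  n * a + sum g∸a             ≡⟨ +-comm (n * a) (sum g∸a) ⟩
  sum g∸a + n * a             ≡⟨ cong (sum g∸a +_) (sum-const n a) ⟨
  sum g∸a + sum {n} (const a) ≡⟨ ∑-distrib-+ g∸a (const a) ⟨
  sum (λ i → g∸a i + a)       ≡⟨ sum-cong-≗ (λ i → m∸n+n≡m (a≤g i)) ⟩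
  sum g                       ∎
  where
  open ≤-Reasoning
  g∸a : Fin n → ℕ
  g∸a i = g i ∸ a
  g∸a-inj : Injective _≡_ _≡_ g∸a
  g∸a-inj {i} {j} eq = g-inj (begin-equality
    g i         ≡⟨ m∸n+n≡m (a≤g i) ⟨
    g i ∸ a + a ≡⟨ cong (_+ a) eq ⟩
    g j ∸ a + a ≡⟨ m∸n+n≡m (a≤g j) ⟩
    g j         ∎)

injective⇒sum+nC2≤n*M : ∀ {n} M (g : Fin n → ℕ) → Injective _≡_ _≡_ g → (∀ i → g i ≤ M) →
                        sum g + n C 2 ≤ n * M
injective⇒sum+nC2≤n*M {n} M g g-inj g≤M = begin
  sum g + n C 2           ≤⟨ +-monoʳ-≤ (sum g) (injective⇒nC2≤sum M∸g M∸g-inj) ⟩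
  sum g + sum M∸g         ≡⟨ ∑-distrib-+ g M∸g ⟨
  sum (λ i → g i + M∸g i) ≡⟨ sum-cong-≗ (λ i → m+[n∸m]≡n (g≤M i)) ⟩
  sum {n} (const M)       ≡⟨ sum-const n M ⟩
  n * M                   ∎
  where
  open ≤-Reasoning
  M∸g : Fin n → ℕ
  M∸g i = M ∸ g i
  M∸g-inj : Injective _≡_ _≡_ M∸g
  M∸g-inj = g-inj ∘ ∸-cancelˡ-≡ (g≤M _) (g≤M _)

⊎-map-injective : ∀ {A B C D : Set} {f : A → C} {g : B → D} →
                  Injective _≡_ _≡_ f → Injective _≡_ _≡_ g → Injective _≡_ _≡_ (Sum.map f g)
⊎-map-injective f-inj g-inj {inj₁ x} {inj₁ y} eq = cong inj₁ (f-inj (inj₁-injective eq))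
⊎-map-injective f-inj g-inj {inj₂ x} {inj₂ y} eq = cong inj₂ (g-inj (inj₂-injective eq))
⊎-map-injective f-inj g-inj {inj₁ x} {inj₂ y} ()
⊎-map-injective f-inj g-inj {inj₂ x} {inj₁ y} ()

splitAt-injective : ∀ m {n} → Injective _≡_ _≡_ (splitAt m {n})
splitAt-injective m {n} {i} {j} eq = begin
  i                          ≡⟨ Fin.join-splitAt m n i ⟨
  Fin.join m n (splitAt m i) ≡⟨ cong (Fin.join m n) eq ⟩
  Fin.join m n (splitAt m j) ≡⟨ Fin.join-splitAt m n j ⟩
  j                          ∎
  where open ≡-Reasoning

pairSum : ∀ {n} → (Fin n ⊎ Fin n → ℕ) → Fin n → ℕ
pairSum w j = w (inj₁ j) + w (inj₂ j)

sum-pairSum : ∀ {n} (w : Fin n ⊎ Fin n → ℕ) → sum (pairSum w) ≡ sum (w ∘ splitAt n)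
sum-pairSum w = trans (∑-distrib-+ (w ∘ inj₁) (w ∘ inj₂)) (sym (sum-splitAt _ w))

all-but-one-exceed : ∀ {n} M (s : Fin (suc n) → ℕ) →
                     (∀ j j' → s j ≤ M → s j' ≤ M → j ≡ j') →
                     ∃ λ e → ∀ k → M < s (punchIn e k)
all-but-one-exceed M s small-unique with any? (λ j → s j ≤? M)
... | yes (e , sₑ≤M) = e , λ k → ≰⇒> λ s≤M → punchInᵢ≢i e k (small-unique _ _ s≤M sₑ≤M)
... | no none        = Fin.zero , λ k → ≰⇒> λ s≤M → none (_ , s≤M)

pairSums-bound : ∀ {c} M (w : Fin (suc c) ⊎ Fin (suc c) → ℕ) →
                 Injective _≡_ _≡_ w → (∀ x → w x ≤ M) → Injective _≡_ _≡_ (pairSum w) →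
                 (∀ j j' → pairSum w j ≤ M → pairSum w j' ≤ M → j ≡ j') →
                 c * suc M + c C 2 + (c + c) C 2 ≤ (c + c) * M
pairSums-bound {c} M w w-inj w≤M sums-inj small-unique
  with all-but-one-exceed M (pairSum w) small-unique
... | e , large = begin
  c * suc M + c C 2 + (c + c) C 2
    ≤⟨ +-monoˡ-≤ ((c + c) C 2) (injective⇒n*a+nC2≤sum (suc M) (pairSum w′) sums′-inj large) ⟩
  sum (pairSum w′) + (c + c) C 2
    ≡⟨ cong (_+ (c + c) C 2) (sum-pairSum w′) ⟩
  sum (w′ ∘ splitAt c) + (c + c) C 2
    ≤⟨ injective⇒sum+nC2≤n*M M (w′ ∘ splitAt c) w′-inj (λ _ → w≤M _) ⟩
  (c + c) * M
    ∎
  where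
  open ≤-Reasoning
  w′ : Fin c ⊎ Fin c → ℕ
  w′ = w ∘ Sum.map (punchIn e) (punchIn e)
  sums′-inj : Injective _≡_ _≡_ (pairSum w′)
  sums′-inj = punchIn-injective e _ _ ∘ sums-inj
  w′-inj : Injective _≡_ _≡_ (w′ ∘ splitAt c)
  w′-inj = splitAt-injective c ∘ ⊎-map-injective (punchIn-injective e _ _) (punchIn-injective e _ _) ∘ w-inj

-- Degrees and vertex sums

mask : ∀ {n} → (Fin n → Bool) → (Fin n → ℕ) → Fin n → ℕ
mask χ w i = if χ i then w i else 0

count : ∀ {n} → (Fin n → Bool) → ℕ
count χ = sum (mask χ (const 1))

sum-mask-remove : ∀ {n} (χ : Fin (suc n) → Bool) (w : Fin (suc n) → ℕ) {i} → χ i ≡ true →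
                  sum (mask χ w) ≡ w i + sum (mask (removeAt χ i) (removeAt w i))
sum-mask-remove χ w {i} χᵢ =
  trans (sum-remove (mask χ w)) (cong (λ b → (if b then w i else 0) + sum (removeAt (mask χ w) i)) χᵢ)

count≡0⇒sum-mask≡0 : ∀ {n} (χ : Fin n → Bool) w → count χ ≡ 0 → sum (mask χ w) ≡ 0
count≡0⇒sum-mask≡0 {zero}  χ w _    = refl
count≡0⇒sum-mask≡0 {suc n} χ w none = cong₂ _+_
  (unselected (χ Fin.zero) (m+n≡0⇒m≡0 _ none))
  (count≡0⇒sum-mask≡0 (χ ∘ Fin.suc) (w ∘ Fin.suc) (m+n≡0⇒n≡0 _ none))
  where
  unselected : ∀ b {x} → (if b then 1 else 0) ≡ 0 → (if b then x else 0) ≡ 0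
  unselected false _ = refl

count≡1+k⇒∃ : ∀ {n k} (χ : Fin n → Bool) → count χ ≡ suc k → ∃ λ i → χ i ≡ true
count≡1+k⇒∃ {suc n} χ some with χ Fin.zero in χ₀
... | true  = Fin.zero , χ₀
... | false = let (i , χᵢ) = count≡1+k⇒∃ (χ ∘ Fin.suc) some in Fin.suc i , χᵢ

count≡1⇒sum-mask : ∀ {n} (χ : Fin n → Bool) (w : Fin n → ℕ) {i} → count χ ≡ 1 → χ i ≡ true →
                   sum (mask χ w) ≡ w i
count≡1⇒sum-mask {suc n} χ w {i} one χᵢ = begin
  sum (mask χ w)        ≡⟨ sum-mask-remove χ w χᵢ ⟩
  w i + sum (mask χ′ w′) ≡⟨ cong (w i +_) (count≡0⇒sum-mask≡0 χ′ w′ rest) ⟩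
  w i + 0               ≡⟨ +-identityʳ (w i) ⟩
  w i                   ∎
  where
  open ≡-Reasoning
  χ′ = removeAt χ i
  w′ = removeAt w i
  rest : count χ′ ≡ 0
  rest = suc-injective (trans (sym (sum-mask-remove χ (const 1) χᵢ)) one)

count≡2⇒∃-other : ∀ {n} (χ : Fin n → Bool) {i} → count χ ≡ 2 → χ i ≡ true →
                  ∃ λ i' → i ≢ i' × χ i' ≡ true
count≡2⇒∃-other {suc n} χ {i} two χᵢ =
  let rest = suc-injective (trans (sym (sum-mask-remove χ (const 1) χᵢ)) two)
      (j , χⱼ) = count≡1+k⇒∃ (removeAt χ i) rest
  in punchIn i j , (λ eq → punchInᵢ≢i i j (sym eq)) , χⱼ

count≡2⇒sum-mask : ∀ {n} (χ : Fin n → Bool) (w : Fin n → ℕ) {i i'} → count χ ≡ 2 →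
                   i ≢ i' → χ i ≡ true → χ i' ≡ true → sum (mask χ w) ≡ w i + w i'
count≡2⇒sum-mask {suc n} χ w {i} {i'} two i≢i' χᵢ χᵢ' = begin
  sum (mask χ w)         ≡⟨ sum-mask-remove χ w χᵢ ⟩
  w i + sum (mask χ′ w′) ≡⟨ cong (w i +_) (count≡1⇒sum-mask χ′ w′ rest χⱼ) ⟩
  w i + w (punchIn i j)  ≡⟨ cong (λ k → w i + w k) (punchIn-punchOut i≢i') ⟩
  w i + w i'             ∎
  where
  open ≡-Reasoning
  j = punchOut i≢i'
  χ′ = removeAt χ i
  w′ = removeAt w i
  rest : count χ′ ≡ 1
  rest = suc-injective (trans (sym (sum-mask-remove χ (const 1) χᵢ)) two)
  χⱼ : χ (punchIn i j) ≡ true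
  χⱼ = trans (cong χ (punchIn-punchOut i≢i')) χᵢ'

infix 4 _∈ₑ_
_∈ₑ_ : ℕ → ℕ × ℕ → Set
v ∈ₑ (a , b) = v ≡ a ⊎ v ≡ b

incident⇒∈ₑ : ∀ {v} e → incident v e ≡ true → v ∈ₑ e
incident⇒∈ₑ {v} (a , b) =
  Sum.map toWitness toWitness ∘ Equivalence.to (T-∨ {⌊ v ≟ a ⌋}) ∘ Equivalence.from T-≡

∈ₑ⇒incident : ∀ {v} e → v ∈ₑ e → incident v e ≡ true
∈ₑ⇒incident {v} (a , b) =
  Equivalence.to T-≡ ∘ Equivalence.from (T-∨ {⌊ v ≟ a ⌋}) ∘ Sum.map fromWitness fromWitness

∉ₑ⇒¬incident : ∀ {v} e → ¬ v ∈ₑ e → incident v e ≡ false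
∉ₑ⇒¬incident e v∉e = ¬-not (v∉e ∘ incident⇒∈ₑ e)

∈ₑ-shift : ∀ k {v} e → v ∈ₑ e → k + v ∈ₑ shift k e
∈ₑ-shift k e = Sum.map (cong (k +_)) (cong (k +_))

incident-shift : ∀ k v e → incident (k + v) (shift k e) ≡ incident v e
incident-shift k v (a , b) = cong₂ _∨_ (≟-shift a) (≟-shift b)
  where
  ≟-shift : ∀ a → ⌊ k + v ≟ k + a ⌋ ≡ ⌊ v ≟ a ⌋
  ≟-shift a = trans (isYes≗does (k + v ≟ k + a))
    (trans (does-⇔ (mk⇔ (+-cancelˡ-≡ k v a) (cong (k +_))) (k + v ≟ k + a) (v ≟ a))
           (sym (isYes≗does (v ≟ a))))

degreeIn : ℕ → List (ℕ × ℕ) → ℕ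
degreeIn v []       = 0
degreeIn v (e ∷ es) = (if incident v e then 1 else 0) + degreeIn v es

degree : Graph → ℕ → ℕ
degree G v = degreeIn v (edges G)

incidentAt : (G : Graph) → ℕ → Fin (nE G) → Bool
incidentAt G v i = incident v (edge G i)

label : (G : Graph) → Labeling G → Fin (nE G) → ℕ
label G f i = suc (toℕ (Bijection.to f i))

degree≡count : ∀ G v → degree G v ≡ count (incidentAt G v)
degree≡count G v = trans (degreeIn≡sumFin (edges G)) (sumFin≡sum (nE G) (mask (incidentAt G v) (const 1)))
  where
  degreeIn≡sumFin : ∀ es →
                    degreeIn v es ≡ sumFin (length es) (λ i → if incident v (lookup es i) then 1 else 0)
  degreeIn≡sumFin []       = refl
  degreeIn≡sumFin (e ∷ es) = cong (_ +_) (degreeIn≡sumFin es)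

vertexSum≡sum-mask : ∀ G (f : Labeling G) v → vertexSum G f v ≡ sum (mask (incidentAt G v) (label G f))
vertexSum≡sum-mask G f v = sumFin≡sum (nE G) (mask (incidentAt G v) (label G f))

vertexSum-leaf : ∀ G (f : Labeling G) {v i} → degree G v ≡ 1 → v ∈ₑ edge G i →
                 vertexSum G f v ≡ label G f i
vertexSum-leaf G f {v} {i} deg v∈eᵢ = trans (vertexSum≡sum-mask G f v)
  (count≡1⇒sum-mask (incidentAt G v) (label G f) (trans (sym (degree≡count G v)) deg)
    (∈ₑ⇒incident (edge G i) v∈eᵢ))

record TwoEdges (G : Graph) (v : ℕ) : Set where
  field
    first second : Fin (nE G)
    distinct     : first ≢ second
    ∈first       : v ∈ₑ edge G first
    ∈second      : v ∈ₑ edge G second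

degree≡2⇒TwoEdges : ∀ G {v} → degree G v ≡ 2 → TwoEdges G v
degree≡2⇒TwoEdges G {v} deg =
  let two = trans (sym (degree≡count G v)) deg
      (i , χᵢ) = count≡1+k⇒∃ (incidentAt G v) two
      (i' , i≢i' , χᵢ') = count≡2⇒∃-other (incidentAt G v) two χᵢ
  in record { first = i ; second = i' ; distinct = i≢i'
            ; ∈first = incident⇒∈ₑ (edge G i) χᵢ ; ∈second = incident⇒∈ₑ (edge G i') χᵢ' }

vertexSum-degree-two : ∀ G (f : Labeling G) {v} → degree G v ≡ 2 → (t : TwoEdges G v) →
                       vertexSum G f v ≡ label G f (TwoEdges.first t) + label G f (TwoEdges.second t)
vertexSum-degree-two G f {v} deg t = trans (vertexSum≡sum-mask G f v)
  (count≡2⇒sum-mask (incidentAt G v) (label G f) (trans (sym (degree≡count G v)) deg) distinct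
    (∈ₑ⇒incident (edge G first) ∈first) (∈ₑ⇒incident (edge G second) ∈second))
  where open TwoEdges t

label-injective : ∀ G (f : Labeling G) → Injective _≡_ _≡_ (label G f)
label-injective G f = Bijection.injective f ∘ Fin.toℕ-injective ∘ suc-injective

label≤nE : ∀ G (f : Labeling G) i → label G f i ≤ nE G
label≤nE G f i = Fin.toℕ<n (Bijection.to f i)

label-surjective : ∀ G (f : Labeling G) s → suc s ≤ nE G → ∃ λ i → label G f i ≡ suc s
label-surjective G f s s<n =
  let (i , toᵢ) = Bijection.surjective f (fromℕ< s<n)
  in i , cong suc (trans (cong toℕ (toᵢ refl)) (Fin.toℕ-fromℕ< s<n))

vertexSum-injective : ∀ G (f : Labeling G) → IsAntimagicLabeling G f → ∀ {u v} →
                      u < nV G → v < nV G → vertexSum G f u ≡ vertexSum G f v → u ≡ v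
vertexSum-injective G f antimagic {u} {v} u<n v<n eq = begin
  u                ≡⟨ Fin.toℕ-fromℕ< u<n ⟨
  toℕ (fromℕ< u<n) ≡⟨ cong toℕ (antimagic (subst₂ (λ x y → vertexSum G f x ≡ vertexSum G f y)
                                             (sym (Fin.toℕ-fromℕ< u<n)) (sym (Fin.toℕ-fromℕ< v<n)) eq)) ⟩
  toℕ (fromℕ< v<n) ≡⟨ Fin.toℕ-fromℕ< v<n ⟩
  v                ∎
  where open ≡-Reasoning

-- Well-formed graphs and disjoint unions

Within : ℕ → ℕ × ℕ → Set
Within n (a , b) = a < n × b < n

WellFormed : Graph → Set
WellFormed G = All (Within (nV G)) (edges G)

HasLeaf : Graph → ℕ × ℕ → Set
HasLeaf G e = ∃ λ u → u ∈ₑ e × degree G u ≡ 1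

∈ₑ-within : ∀ {n v} e → Within n e → v ∈ₑ e → v < n
∈ₑ-within e (a<n , b<n) = Sum.[ (λ { refl → a<n }) , (λ { refl → b<n }) ]

degreeIn≡1+k⇒within : ∀ {n v k} es → All (Within n) es → degreeIn v es ≡ suc k → v < n
degreeIn≡1+k⇒within {v = v} (e ∷ es) (e-within ∷ es-within) pos with incident v e in v∈e
... | true  = ∈ₑ-within e e-within (incident⇒∈ₑ e v∈e)
... | false = degreeIn≡1+k⇒within es es-within pos

degree≡1+k⇒vertex : ∀ {G v k} → WellFormed G → degree G v ≡ suc k → v < nV G
degree≡1+k⇒vertex {G} = degreeIn≡1+k⇒within (edges G)

degreeIn-++ : ∀ v xs ys → degreeIn v (xs ++ ys) ≡ degreeIn v xs + degreeIn v ys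
degreeIn-++ v []       ys = refl
degreeIn-++ v (x ∷ xs) ys =
  trans (cong (_ +_) (degreeIn-++ v xs ys)) (sym (+-assoc (if incident v x then 1 else 0) _ _))

degreeIn-∉ : ∀ {v} es → All (λ e → ¬ v ∈ₑ e) es → degreeIn v es ≡ 0
degreeIn-∉ []       []           = refl
degreeIn-∉ (e ∷ es) (v∉e ∷ v∉es) =
  cong₂ _+_ (cong (if_then 1 else 0) (∉ₑ⇒¬incident e v∉e)) (degreeIn-∉ es v∉es)

degreeIn-shift : ∀ k v es → degreeIn (k + v) (map (shift k) es) ≡ degreeIn v es
degreeIn-shift k v []       = refl
degreeIn-shift k v (e ∷ es) =
  cong₂ _+_ (cong (if_then 1 else 0) (incident-shift k v e)) (degreeIn-shift k v es)

degree-⊕ˡ : ∀ {G H v} → v < nV G → degree (G ⊕ H) v ≡ degree G v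
degree-⊕ˡ {G} {H} {v} v<n = begin
  degreeIn v (edges G ++ shifted)   ≡⟨ degreeIn-++ v (edges G) shifted ⟩
  degree G v + degreeIn v shifted   ≡⟨ cong (degree G v +_) (degreeIn-∉ shifted v∉shifted) ⟩
  degree G v + 0                    ≡⟨ +-identityʳ _ ⟩
  degree G v                        ∎
  where
  open ≡-Reasoning
  shifted = map (shift (nV G)) (edges H)
  ∉-shifted : ∀ e → ¬ v ∈ₑ shift (nV G) e
  ∉-shifted (a , b) = Sum.[ (λ eq → m+n≮m (nV G) a (subst (_< nV G) eq v<n)) ,
                             (λ eq → m+n≮m (nV G) b (subst (_< nV G) eq v<n)) ]
  v∉shifted : All (λ e → ¬ v ∈ₑ e) shifted
  v∉shifted = map⁺ (All.universal ∉-shifted (edges H))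

degree-⊕ʳ : ∀ {G H} u → WellFormed G → degree (G ⊕ H) (nV G + u) ≡ degree H u
degree-⊕ʳ {G} {H} u wf = trans (degreeIn-++ (nV G + u) (edges G) _)
  (cong₂ _+_ (degreeIn-∉ (edges G) (All.map (λ {e} e-within → m+n≮m (nV G) u ∘ ∈ₑ-within e e-within) wf))
             (degreeIn-shift (nV G) u (edges H)))

wellFormed-⊕ : ∀ {G H} → WellFormed G → WellFormed H → WellFormed (G ⊕ H)
wellFormed-⊕ {G} {H} wfG wfH =
  ++⁺ (All.map (Product.map widen widen) wfG)
      (map⁺ (All.map (Product.map (+-monoʳ-< (nV G)) (+-monoʳ-< (nV G))) wfH))
  where
  widen : ∀ {v} → v < nV G → v < nV G + nV H
  widen v<n = <-≤-trans v<n (m≤m+n (nV G) (nV H))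

leaves-⊕ : ∀ {G H xs} → WellFormed G → All (HasLeaf G) xs → All (HasLeaf H) (edges H) →
           All (HasLeaf (G ⊕ H)) (xs ++ map (shift (nV G)) (edges H))
leaves-⊕ {G} {H} wfG leavesG leavesH = ++⁺ (All.map leafˡ leavesG) (map⁺ (All.map leafʳ leavesH))
  where
  leafˡ : ∀ {e} → HasLeaf G e → HasLeaf (G ⊕ H) e
  leafˡ (u , u∈e , deg) = u , u∈e , trans (degree-⊕ˡ {G} {H} (degree≡1+k⇒vertex wfG deg)) deg
  leafʳ : ∀ {e} → HasLeaf H e → HasLeaf (G ⊕ H) (shift (nV G) e)
  leafʳ {e} (u , u∈e , deg) = nV G + u , ∈ₑ-shift (nV G) e u∈e , trans (degree-⊕ʳ {G} {H} u wfG) deg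

-- Antimagic graphs with many independent vertices of degree two

-- Independence of D is only assumed at e₀: every other edge has an endpoint of degree 1.
module _ {c : ℕ} {G : Graph} (wf : WellFormed G) {f : Labeling G} (antimagic : IsAntimagicLabeling G f)
         (e₀ : Fin (nE G)) (leaf : ∀ i → i ≢ e₀ → HasLeaf G (edge G i))
         {D : Fin (suc c) → ℕ} (D-injective : Injective _≡_ _≡_ D) (D-degree : ∀ j → degree G (D j) ≡ 2)
         (e₀-not-within-D : ∀ j j' → edge G e₀ ≢ (D j , D j')) where

  private
    edgesAt : ∀ j → TwoEdges G (D j)
    edgesAt j = degree≡2⇒TwoEdges G (D-degree j)

    ends : Fin (suc c) ⊎ Fin (suc c) → Fin (nE G)
    ends = Sum.[ TwoEdges.first ∘ edgesAt , TwoEdges.second ∘ edgesAt ]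

    endLabel : Fin (suc c) ⊎ Fin (suc c) → ℕ
    endLabel = label G f ∘ ends

  leaf≢D : ∀ {u} j → degree G u ≡ 1 → u ≢ D j
  leaf≢D j deg₁ u≡Dⱼ with () ← trans (sym deg₁) (trans (cong (degree G) u≡Dⱼ) (D-degree j))

  no-edge-within-D : ∀ i j j' → edge G i ≢ (D j , D j')
  no-edge-within-D i j j' eq with i Fin.≟ e₀
  ... | yes refl = e₀-not-within-D j j' eq
  ... | no i≢e₀  =
    let (u , u∈eᵢ , deg₁) = leaf i i≢e₀
    in Sum.[ leaf≢D j deg₁ , leaf≢D j' deg₁ ] (subst (u ∈ₑ_) eq u∈eᵢ)

  edge-meets-one-D : ∀ {i j j'} → D j ∈ₑ edge G i → D j' ∈ₑ edge G i → j ≡ j'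
  edge-meets-one-D              (inj₁ p) (inj₁ q) = D-injective (trans p (sym q))
  edge-meets-one-D              (inj₂ p) (inj₂ q) = D-injective (trans p (sym q))
  edge-meets-one-D {i} {j} {j'} (inj₁ p) (inj₂ q) = ⊥-elim (no-edge-within-D i j j' (cong₂ _,_ (sym p) (sym q)))
  edge-meets-one-D {i} {j} {j'} (inj₂ p) (inj₁ q) = ⊥-elim (no-edge-within-D i j' j (cong₂ _,_ (sym q) (sym p)))

  D∈ends : ∀ x → D (Sum.reduce x) ∈ₑ edge G (ends x)
  D∈ends (inj₁ j) = TwoEdges.∈first (edgesAt j)
  D∈ends (inj₂ j) = TwoEdges.∈second (edgesAt j)

  ends-injective : Injective _≡_ _≡_ ends
  ends-injective {x} {y} eq = same-owner x y (edge-meets-one-D (D∈ends x) D-y∈ends-x) eq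
    where
    D-y∈ends-x : D (Sum.reduce y) ∈ₑ edge G (ends x)
    D-y∈ends-x = subst (λ i → D (Sum.reduce y) ∈ₑ edge G i) (sym eq) (D∈ends y)
    same-owner : ∀ x y → Sum.reduce x ≡ Sum.reduce y → ends x ≡ ends y → x ≡ y
    same-owner (inj₁ j) (inj₁ .j) refl _  = refl
    same-owner (inj₂ j) (inj₂ .j) refl _  = refl
    same-owner (inj₁ j) (inj₂ .j) refl eq = ⊥-elim (TwoEdges.distinct (edgesAt j) eq)
    same-owner (inj₂ j) (inj₁ .j) refl eq = ⊥-elim (TwoEdges.distinct (edgesAt j) (sym eq))

  vertexSum-D : ∀ j → vertexSum G f (D j) ≡ pairSum endLabel j
  vertexSum-D j = vertexSum-degree-two G f (D-degree j) (edgesAt j)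

  pairSum-injective : Injective _≡_ _≡_ (pairSum endLabel)
  pairSum-injective {j} {j'} eq = D-injective (vertexSum-injective G f antimagic
    (degree≡1+k⇒vertex wf (D-degree j)) (degree≡1+k⇒vertex wf (D-degree j'))
    (trans (vertexSum-D j) (trans eq (sym (vertexSum-D j')))))

  -- A pair sum ≤ nE G is a label; unless it is the label of e₀, a leaf has the same vertex sum.
  small-pairSum : ∀ j → pairSum endLabel j ≤ nE G → pairSum endLabel j ≡ label G f e₀
  small-pairSum j small with label-surjective G f _ small
  ... | i , ℓᵢ≡ with i Fin.≟ e₀
  ...   | yes refl = sym ℓᵢ≡
  ...   | no i≢e₀  =
    let (u , u∈eᵢ , deg₁) = leaf i i≢e₀
    in ⊥-elim (leaf≢D j deg₁ (vertexSum-injective G f antimagic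
         (degree≡1+k⇒vertex wf deg₁) (degree≡1+k⇒vertex wf (D-degree j))
         (trans (vertexSum-leaf G f deg₁ u∈eᵢ) (trans ℓᵢ≡ (sym (vertexSum-D j))))))

  antimagic⇒degree-two-bound : c * suc (nE G) + c C 2 + (c + c) C 2 ≤ (c + c) * nE G
  antimagic⇒degree-two-bound =
    pairSums-bound (nE G) endLabel (ends-injective ∘ label-injective G f) (label≤nE G f ∘ ends) pairSum-injective
      (λ j j' small small' → pairSum-injective (trans (small-pairSum j small) (sym (small-pairSum j' small'))))

-- The double star S_{1,b} and copies of P₃

length-leavesAt : ∀ c s k → length (leavesAt c s k) ≡ k
length-leavesAt c s zero    = refl
length-leavesAt c s (suc k) = cong suc (length-leavesAt c s k)

leavesAt-shape : ∀ c s k → All (λ e → ∃ λ t → t < k × e ≡ (c , s + t)) (leavesAt c s k)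
leavesAt-shape c s zero    = []
leavesAt-shape c s (suc k) =
  (k , n<1+n k , refl) ∷ All.map (λ (t , t<k , eq) → t , m<n⇒m<1+n t<k , eq) (leavesAt-shape c s k)

degreeIn-leavesAt-∉ : ∀ c s k {v} → v ≢ c → (∀ t → t < k → v ≢ s + t) →
                      degreeIn v (leavesAt c s k) ≡ 0
degreeIn-leavesAt-∉ c s k v≢c v≢leaf =
  degreeIn-∉ _ (All.map (λ { (t , t<k , refl) → Sum.[ v≢c , v≢leaf t t<k ] }) (leavesAt-shape c s k))

degreeIn-leavesAt-leaf : ∀ c s {k t} → s + t ≢ c → t < k → degreeIn (s + t) (leavesAt c s k) ≡ 1
degreeIn-leavesAt-leaf c s {suc k} {t} s+t≢c t<1+k with m<1+n⇒m<n∨m≡n t<1+k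
... | inj₂ refl = cong₂ _+_ (cong (if_then 1 else 0) (∈ₑ⇒incident (c , s + t) (inj₂ refl)))
                            (degreeIn-leavesAt-∉ c s t s+t≢c
                              (λ t' t'<t eq → <⇒≢ t'<t (sym (+-cancelˡ-≡ s t t' eq))))
... | inj₁ t<k  = cong₂ _+_ (cong (if_then 1 else 0) (∉ₑ⇒¬incident (c , s + k)
                              Sum.[ s+t≢c , (λ eq → <⇒≢ t<k (+-cancelˡ-≡ s t k eq)) ]))
                            (degreeIn-leavesAt-leaf c s s+t≢c t<k)

wellFormed-P3 : WellFormed P3
wellFormed-P3 = (z<s , s<s z<s) ∷ (s<s z<s , s<s (s<s z<s)) ∷ []

wellFormed-copiesP3 : ∀ c → WellFormed (copiesP3 c)
wellFormed-copiesP3 zero    = []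
wellFormed-copiesP3 (suc c) = wellFormed-⊕ wellFormed-P3 (wellFormed-copiesP3 c)

leaves-copiesP3 : ∀ c → All (HasLeaf (copiesP3 c)) (edges (copiesP3 c))
leaves-copiesP3 zero    = []
leaves-copiesP3 (suc c) = leaves-⊕ {P3} {copiesP3 c} wellFormed-P3
  ((0 , inj₁ refl , refl) ∷ (2 , inj₂ refl , refl) ∷ []) (leaves-copiesP3 c)

degree-copiesP3-centre : ∀ {c k} → k < c → degree (copiesP3 c) (1 + k * 3) ≡ 2
degree-copiesP3-centre {suc c} {zero}  _         = degree-⊕ˡ {P3} {copiesP3 c} (s<s z<s)
degree-copiesP3-centre {suc c} {suc k} (s<s k<c) =
  trans (degree-⊕ʳ {P3} {copiesP3 c} (1 + k * 3) wellFormed-P3) (degree-copiesP3-centre k<c)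

nE-copiesP3 : ∀ c → nE (copiesP3 c) ≡ c + c
nE-copiesP3 zero    = refl
nE-copiesP3 (suc c) =
  trans (cong (2 +_) (trans (length-map (shift 3) (edges (copiesP3 c))) (nE-copiesP3 c)))
        (cong suc (sym (+-suc c c)))

module _ (b : ℕ) where

  doubleStar-≤2<nV : ∀ {v} → v ≤ 2 → v < nV (doubleStar 1 b)
  doubleStar-≤2<nV v≤2 = s≤s (≤-trans v≤2 (m≤n+m 2 b))

  doubleStar-leaf<nV : ∀ {t} → t < b → 3 + t < nV (doubleStar 1 b)
  doubleStar-leaf<nV {t} t<b = s≤s (subst (3 + t ≤_) (+-comm 2 b) (+-monoʳ-≤ 2 t<b))

  wellFormed-doubleStar : WellFormed (doubleStar 1 b)
  wellFormed-doubleStar =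
    (doubleStar-≤2<nV z≤n , doubleStar-≤2<nV (s≤s z≤n)) ∷
    (doubleStar-≤2<nV z≤n , doubleStar-≤2<nV ≤-refl) ∷
    All.map (λ { (t , t<b , refl) → doubleStar-≤2<nV (s≤s z≤n) , doubleStar-leaf<nV t<b })
            (leavesAt-shape 1 3 b)

  degree-doubleStar-x : degree (doubleStar 1 b) 0 ≡ 2
  degree-doubleStar-x = cong (2 +_) (degreeIn-leavesAt-∉ 1 3 b (λ ()) (λ _ _ ()))

  leaves-doubleStar : All (HasLeaf (doubleStar 1 b)) ((0 , 2) ∷ leavesAt 1 3 b)
  leaves-doubleStar =
    (2 , inj₂ refl , cong (1 +_) (degreeIn-leavesAt-∉ 1 3 b (λ ()) (λ _ _ ()))) ∷
    All.map (λ { (t , t<b , refl) → 3 + t , inj₂ refl , degreeIn-leavesAt-leaf 1 3 (λ ()) t<b })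
            (leavesAt-shape 1 3 b)

module _ (b c : ℕ) where

  private
    S = doubleStar 1 b
    G = doubleStar 1 b ⊕ copiesP3 c

  wellFormed-G : WellFormed G
  wellFormed-G = wellFormed-⊕ (wellFormed-doubleStar b) (wellFormed-copiesP3 c)

  leaves-G : ∀ i → i ≢ Fin.zero → HasLeaf G (edge G i)
  leaves-G Fin.zero    0≢0 = ⊥-elim (0≢0 refl)
  leaves-G (Fin.suc i) _   = All.lookup
    (leaves-⊕ {S} {copiesP3 c} (wellFormed-doubleStar b) (leaves-doubleStar b) (leaves-copiesP3 c))
    (∈-lookup i)

  -- x, then the centres of the copies of P₃
  middle : Fin (suc c) → ℕ
  middle Fin.zero    = 0
  middle (Fin.suc k) = nV S + (1 + toℕ k * 3)

  middle-degree : ∀ j → degree G (middle j) ≡ 2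
  middle-degree Fin.zero    = trans (degree-⊕ˡ {S} {copiesP3 c} (doubleStar-≤2<nV b z≤n)) (degree-doubleStar-x b)
  middle-degree (Fin.suc k) =
    trans (degree-⊕ʳ {S} {copiesP3 c} _ (wellFormed-doubleStar b)) (degree-copiesP3-centre (Fin.toℕ<n k))

  middle-injective : Injective _≡_ _≡_ middle
  middle-injective {Fin.zero}  {Fin.zero}   _  = refl
  middle-injective {Fin.suc k} {Fin.suc k'} eq =
    cong Fin.suc (Fin.toℕ-injective (*-cancelʳ-≡ _ _ 3 (suc-injective (+-cancelˡ-≡ (nV S) _ _ eq))))
  middle-injective {Fin.zero}  {Fin.suc _}  ()
  middle-injective {Fin.suc _} {Fin.zero}   ()

  middle≢y : ∀ j → middle j ≢ 1
  middle≢y Fin.zero    ()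
  middle≢y (Fin.suc k) eq = <⇒≢ (<-≤-trans (doubleStar-≤2<nV b (s≤s z≤n)) (m≤m+n (nV S) _)) (sym eq)

  xy-not-within-middle : ∀ j j' → edge G Fin.zero ≢ (middle j , middle j')
  xy-not-within-middle j j' eq = middle≢y j' (sym (cong Product.proj₂ eq))

  nE-G : nE G ≡ (b + 2) + (c + c)
  nE-G = begin
    2 + length (leavesAt 1 3 b ++ map (shift (nV S)) (edges (copiesP3 c)))
      ≡⟨ cong (2 +_) (length-++ (leavesAt 1 3 b)) ⟩
    2 + (length (leavesAt 1 3 b) + length (map (shift (nV S)) (edges (copiesP3 c))))
      ≡⟨ cong₂ (λ x y → 2 + (x + y)) (length-leavesAt 1 3 b)
               (trans (length-map (shift (nV S)) (edges (copiesP3 c))) (nE-copiesP3 c)) ⟩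
    2 + (b + (c + c))
      ≡⟨ cong (_+ (c + c)) (+-comm 2 b) ⟩
    (b + 2) + (c + c)
      ∎
    where open ≡-Reasoning

-- Doubling and 2 · (n C 2) + n = n² turn the bound into c² ≤ c (2m + 1).
degree-two-bound⇒c≤2m+1 : ∀ m c M → M ≡ m + (c + c) →
                          c * suc M + c C 2 + (c + c) C 2 ≤ (c + c) * M → c ≤ 2 * m + 1
degree-two-bound⇒c≤2m+1 m zero      _ _    _     = z≤n
degree-two-bound⇒c≤2m+1 m c@(suc _) _ refl bound =
  *-cancelˡ-≤ c (+-cancelʳ-≤ K (c * c) (c * (2 * m + 1)) (begin
    c * c + K                                   ≡⟨ doubled-lhs ⟨
    2 * (c * suc M + c C 2 + cc C 2) + (c + cc) ≤⟨ +-monoˡ-≤ (c + cc) (*-monoʳ-≤ 2 bound) ⟩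
    2 * (cc * M) + (c + cc)                     ≡⟨ doubled-rhs m c ⟩
    c * (2 * m + 1) + K                         ∎))
  where
  open ≤-Reasoning
  cc = c + c
  M  = m + cc
  K  = 2 * c * m + 8 * c * c + 2 * c
  regroup : ∀ m c x y → 2 * (c * suc (m + (c + c)) + x + y) + (c + (c + c)) ≡
                        2 * (c * suc (m + (c + c))) + (2 * x + c) + (2 * y + (c + c))
  regroup = solve-∀
  collect : ∀ m c → 2 * (c * suc (m + (c + c))) + c * c + (c + c) * (c + c) ≡
                    c * c + (2 * c * m + 8 * c * c + 2 * c)
  collect = solve-∀
  doubled-rhs : ∀ m c → 2 * ((c + c) * (m + (c + c))) + (c + (c + c)) ≡
                        c * (2 * m + 1) + (2 * c * m + 8 * c * c + 2 * c)
  doubled-rhs = solve-∀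
  doubled-lhs : 2 * (c * suc M + c C 2 + cc C 2) + (c + cc) ≡ c * c + K
  doubled-lhs = begin-equality
    2 * (c * suc M + c C 2 + cc C 2) + (c + cc)
      ≡⟨ regroup m c (c C 2) (cc C 2) ⟩
    2 * (c * suc M) + (2 * (c C 2) + c) + (2 * (cc C 2) + cc)
      ≡⟨ cong₂ (λ x y → 2 * (c * suc M) + x + y) (2*nC2+n≡n*n c) (2*nC2+n≡n*n cc) ⟩
    2 * (c * suc M) + c * c + cc * cc
      ≡⟨ collect m c ⟩
    c * c + K
      ∎

lemma1 : (b c : ℕ) → 1 ≤ b →
         Antimagic (doubleStar 1 b ⊕ copiesP3 c) →
         c ≤ 2 * (b + 2) + 1
lemma1 b c _ (f , antimagic) =
  degree-two-bound⇒c≤2m+1 (b + 2) c _ (nE-G b c)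
    (antimagic⇒degree-two-bound {G = doubleStar 1 b ⊕ copiesP3 c} (wellFormed-G b c) {f} antimagic
       Fin.zero (leaves-G b c) (middle-injective b c) (middle-degree b c) (xy-not-within-middle b c))
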